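{- Let $f$ be a positive integer and write $f=2t-1-\eta$ with $\eta\in \{0, 1\}$ and $t$ integers. If $f\geq 5$, then at least one of the following statements holds. (A) $\eta=0$ and $\sigma^{**}(3^f)$ has a prime factor $p_1$ with $5<p_1\leq (3^t-1)/2$; (B) $p_1=5\mid\sigma^{**}(3^f)$ and $f\equiv 2\pmod{4}$ or $f=7, 8$; (C) $\sigma^{**}(3^f)$ has an odd prime factor $p_1$ with $5<p_1\leq\sqrt{(3^{t-\eta}-1)/2}$; or (D) $4$ divides $t$, $\eta=1$, and $p_1=(3^{t-1}-1)/2$ is prime.
   Context: A divisor $d$ of a positive integer $N$ is a unitary divisor if $\gcd(d,N/d)=1$; $d$ is a biunitary divisor of $N$ if the greatest common unitary divisor of $d$ and $N/d$ is $1$. $\sigma^{**}(N)$ denotes the sum of the biunitary divisors of $N$. It is multiplicative, and for a prime $p$ and $e=2s-1-\delta$ with $\delta\in\{0,1\}$ one has $\sigma^{**}(p^e)=\frac{(p^{s-\delta}-1)(p^s+1)}{p-1}$ (i.e. $\sigma^{**}(p^e)=(p^{e+1}-1)/(p-1)$ for $e$ odd and $(p^{e+1}-1)/(p-1)-p^{e/2}$ for $e$ even). In particular $\sigma^{**}(3^f)=(3^t+1)(3^{t-\eta}-1)/2$. -}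

module Defs where

open import Data.Nat using (ℕ; zero; suc; _+_; _*_; _∸_; _^_; _≡ᵇ_)
open import Data.Nat.DivMod using (_/_; _%_)
open import Data.Nat.GCD using (gcd)
open import Data.Bool using (Bool; true; false; _∧_; if_then_else_)

isUnitaryDivisor : ℕ → ℕ → Bool
isUnitaryDivisor zero    n = false
isUnitaryDivisor (suc k) n = ((n % suc k) ≡ᵇ 0) ∧ (gcd (suc k) (n / suc k) ≡ᵇ 1)

gcudUpTo : ℕ → ℕ → ℕ → ℕ
gcudUpTo zero    a b = 0
gcudUpTo (suc g) a b =
  if isUnitaryDivisor (suc g) a ∧ isUnitaryDivisor (suc g) b
  then suc g else gcudUpTo g a b

-- greatest common unitary divisor of a and b (a ≥ 1; every common unitary
-- divisor of a is ≤ a, and 1 is always one)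
gcud : ℕ → ℕ → ℕ
gcud a b = gcudUpTo a a b

isBiunitaryDivisor : ℕ → ℕ → Bool
isBiunitaryDivisor zero    N = false
isBiunitaryDivisor (suc k) N = ((N % suc k) ≡ᵇ 0) ∧ (gcud (suc k) (N / suc k) ≡ᵇ 1)

σ**UpTo : ℕ → ℕ → ℕ
σ**UpTo zero    N = 0
σ**UpTo (suc d) N = (if isBiunitaryDivisor (suc d) N then suc d else 0) + σ**UpTo d N

-- σ**(N) = sum of the biunitary divisors of N (all divisors of N ≥ 1 lie in [1, N])
σ** : ℕ → ℕ
σ** N = σ**UpTo N N

-- For f ≥ 1 the biunitary divisors of a prime power p^f are exactly the p^j with 2j ≠ f.  Writing
-- R k = 1 + p + ⋯ + p^(k-1), this gives σ**(p^(2t-1)) = R t (p^t + 1) and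
-- σ**(p^(2s)) = R s (p^(s+1) + 1); for p = 3, R t = (3^t - 1)/2 and R k ∣ R (2k).
-- For odd k, R k ≡ 1 or 13 (mod 30), so all prime factors of R k exceed 5.  Halving even
-- indices then yields a prime factor > 5 of R k for every k ≥ 3 except k = 4 (R 4 = 40),
-- the index 8 being covered by 41 ∣ R 8.  So an odd f gives (A) unless f = 7, and f = 2s
-- with s even gives (C), because a prime factor of R (s/2), or 41 when s = 8, has square at
-- most R s; the exception is f = 8.  For s ≡ 1 (mod 4), 5 ∣ 3^(s+1) + 1 gives (B); for
-- s ≡ 3 (mod 4), R s is either prime, giving (D), or its least prime factor is > 5 and at
-- most √(R s), giving (C).

module Submission where

open import Defs
open import Data.Nat using (ℕ; _+_; _*_; _∸_; _^_; _≤_; _<_)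
open import Data.Nat.DivMod using (_/_; _%_)
open import Data.Nat.Divisibility using (_∣_)
open import Data.Nat.Primality using (Prime)
open import Data.Product using (Σ; _×_)
open import Data.Sum using (_⊎_)
open import Relation.Binary.PropositionalEquality using (_≡_)

open import Data.Bool using (true; false; _∧_; T; if_then_else_)
open import Data.Bool.Properties using (¬-not)
open import Data.Fin using (zero; suc)
open import Data.Nat
open import Data.Nat.Coprimality using (Coprime; coprime?; coprime-divisor; gcd≡1⇒coprime)
open import Data.Nat.DivMod
open import Data.Nat.Divisibility
open import Data.Nat.GCD using (gcd-zeroˡ; gcd-zeroʳ)
open import Data.Nat.Induction using (<-rec)
open import Data.Nat.Primality
open import Data.Nat.Properties
open import Data.Nat.Tactic.RingSolver using (solve-∀)
open import Data.Product using (∃-syntax; _,_; proj₁)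
open import Data.Sum using (inj₁; inj₂)
open import Function using (_∘_)
open import Relation.Nullary using (¬_; Dec; yes; no; contradiction)
open import Relation.Nullary.Decidable using (from-yes)
open import Relation.Binary.PropositionalEquality
  using (_≢_; refl; sym; trans; cong; cong₂; subst; module ≡-Reasoning)

open ≡-Reasoning

-- Repunits

m*2≡m+m : ∀ m → m * 2 ≡ m + m
m*2≡m+m = solve-∀

repunit : ℕ → ℕ → ℕ
repunit b zero    = 0
repunit b (suc k) = b ^ k + repunit b k

repunit-horner : ∀ b k → repunit b (suc k) ≡ 1 + b * repunit b k
repunit-horner b zero    = cong suc (sym (*-zeroʳ b))
repunit-horner b (suc k) = begin
  b * b ^ k + repunit b (suc k)      ≡⟨ cong (b * b ^ k +_) (repunit-horner b k) ⟩
  b * b ^ k + (1 + b * repunit b k)  ≡⟨ lemma b (b ^ k) (repunit b k) ⟩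
  1 + b * (b ^ k + repunit b k)      ∎
  where
  lemma : ∀ b x y → b * x + (1 + b * y) ≡ 1 + b * (x + y)
  lemma = solve-∀

repunit-+ : ∀ b m n → repunit b (m + n) ≡ repunit b m + b ^ m * repunit b n
repunit-+ b m zero    = trans (cong (repunit b) (+-identityʳ m)) (sym (lemma (repunit b m) (b ^ m)))
  where
  lemma : ∀ x y → x + y * 0 ≡ x
  lemma = solve-∀
repunit-+ b m (suc n) = begin
  repunit b (m + suc n)                       ≡⟨ cong (repunit b) (+-suc m n) ⟩
  b ^ (m + n) + repunit b (m + n)
    ≡⟨ cong₂ _+_ (^-distribˡ-+-* b m n) (repunit-+ b m n) ⟩
  b ^ m * b ^ n + (repunit b m + b ^ m * repunit b n)
    ≡⟨ lemma (b ^ m) (b ^ n) (repunit b m) (repunit b n) ⟩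
  repunit b m + b ^ m * (b ^ n + repunit b n) ∎
  where
  lemma : ∀ x y u v → x * y + (u + x * v) ≡ u + x * (y + v)
  lemma = solve-∀

repunit-double : ∀ b k → repunit b (k * 2) ≡ repunit b k * (1 + b ^ k)
repunit-double b k = begin
  repunit b (k * 2)                    ≡⟨ cong (repunit b) (m*2≡m+m k) ⟩
  repunit b (k + k)                    ≡⟨ repunit-+ b k k ⟩
  repunit b k + b ^ k * repunit b k    ≡⟨ lemma (repunit b k) (b ^ k) ⟩
  repunit b k * (1 + b ^ k)            ∎
  where
  lemma : ∀ x y → x + y * x ≡ x * (1 + y)
  lemma = solve-∀

repunit-geometric : ∀ c k → suc c ^ k ≡ 1 + c * repunit (suc c) k
repunit-geometric c zero    = cong suc (sym (*-zeroʳ c))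
repunit-geometric c (suc k) = begin
  suc c * suc c ^ k                         ≡⟨ cong (suc c *_) ih ⟩
  suc c * (1 + c * r)                       ≡⟨ lemma c r ⟩
  1 + c * ((1 + c * r) + r)                 ≡⟨ cong (λ x → 1 + c * (x + r)) (sym ih) ⟩
  1 + c * (suc c ^ k + r)                   ∎
  where
  r = repunit (suc c) k
  ih = repunit-geometric c k
  lemma : ∀ c r → suc c * (1 + c * r) ≡ 1 + c * ((1 + c * r) + r)
  lemma = solve-∀

[[1+c]^k∸1]/c≡repunit : ∀ c k .{{_ : NonZero c}} → (suc c ^ k ∸ 1) / c ≡ repunit (suc c) k
[[1+c]^k∸1]/c≡repunit c k = begin
  (suc c ^ k ∸ 1) / c     ≡⟨ cong (λ x → (x ∸ 1) / c) (repunit-geometric c k) ⟩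
  c * repunit (suc c) k / c ≡⟨ cong (_/ c) (*-comm c _) ⟩
  repunit (suc c) k * c / c ≡⟨ m*n/n≡m _ c ⟩
  repunit (suc c) k       ∎

repunit<^ : ∀ c .{{_ : NonZero c}} k → repunit (suc c) k < suc c ^ k
repunit<^ c k = subst (repunit (suc c) k <_) (sym (repunit-geometric c k)) (s≤s (m≤n*m _ c))

repunit²≤repunit-double : ∀ c .{{_ : NonZero c}} k →
                          repunit (suc c) k * repunit (suc c) k ≤ repunit (suc c) (k * 2)
repunit²≤repunit-double c k = ≤-trans
  (*-monoʳ-≤ (repunit (suc c) k) (m≤n⇒m≤1+n (<⇒≤ (repunit<^ c k))))
  (≤-reflexive (sym (repunit-double (suc c) k)))

repunit∣repunit-double : ∀ b k → repunit b k ∣ repunit b (k * 2)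
repunit∣repunit-double b k = subst (repunit b k ∣_) (sym (repunit-double b k)) (m∣m*n _)

repunit≢0 : ∀ b .{{_ : NonZero b}} k .{{_ : NonZero k}} → NonZero (repunit b k)
repunit≢0 b (suc k) = >-nonZero (<-≤-trans (m^n>0 b k) (m≤m+n (b ^ k) _))

-- Biunitary divisors of prime powers

≡ᵇ∧≡ᵇ⇒≡×≡ : ∀ {a b c d} → ((a ≡ᵇ b) ∧ (c ≡ᵇ d)) ≡ true → a ≡ b × c ≡ d
≡ᵇ∧≡ᵇ⇒≡×≡ {a} {b} {c} {d} eq with a ≡ᵇ b in a≡ᵇb
... | true = ≡ᵇ⇒≡ a b (subst T (sym a≡ᵇb) _) , ≡ᵇ⇒≡ c d (subst T (sym eq) _)

isUnitaryDivisor⇒∣×coprime : ∀ {d n} .{{_ : NonZero d}} → isUnitaryDivisor d n ≡ true →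
                             d ∣ n × Coprime d (n / d)
isUnitaryDivisor⇒∣×coprime {suc k} {n} isUD =
  let n%d≡0 , gcd≡1 = ≡ᵇ∧≡ᵇ⇒≡×≡ isUD
  in  m%n≡0⇒n∣m n (suc k) n%d≡0 , gcd≡1⇒coprime gcd≡1

isUnitaryDivisor[1,n] : ∀ n → isUnitaryDivisor 1 n ≡ true
isUnitaryDivisor[1,n] n rewrite n%1≡0 n | gcd-zeroˡ (n / 1) = refl

isUnitaryDivisor[n,n] : ∀ n .{{_ : NonZero n}} → isUnitaryDivisor n n ≡ true
isUnitaryDivisor[n,n] (suc k)
  rewrite n%n≡0 (suc k) {{_}} | n/n≡1 (suc k) {{_}} | gcd-zeroʳ (suc k) = refl

gcudUpTo≡1 : ∀ m {a b} → (∀ g → isUnitaryDivisor g a ≡ true → isUnitaryDivisor g b ≡ true → g ≡ 1) →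
             gcudUpTo (suc m) a b ≡ 1
gcudUpTo≡1 zero {a} {b} _ rewrite isUnitaryDivisor[1,n] a | isUnitaryDivisor[1,n] b = refl
gcudUpTo≡1 (suc m) {a} {b} common
  with isUnitaryDivisor (suc (suc m)) a in g∣ᵤa | isUnitaryDivisor (suc (suc m)) b in g∣ᵤb
... | true  | true  = contradiction (common _ g∣ᵤa g∣ᵤb) λ ()
... | true  | false = gcudUpTo≡1 m common
... | false | _     = gcudUpTo≡1 m common

gcud≡1 : ∀ {a b} .{{_ : NonZero a}} →
         (∀ g → isUnitaryDivisor g a ≡ true → isUnitaryDivisor g b ≡ true → g ≡ 1) → gcud a b ≡ 1
gcud≡1 {suc m} = gcudUpTo≡1 m

gcud[n,n]≡n : ∀ n .{{_ : NonZero n}} → gcud n n ≡ n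
gcud[n,n]≡n (suc m) rewrite isUnitaryDivisor[n,n] (suc m) {{_}} = refl

isBiunitaryDivisor⇒∣ : ∀ {d N} → isBiunitaryDivisor d N ≡ true → d ∣ N
isBiunitaryDivisor⇒∣ {suc k} {N} isBUD =
  m%n≡0⇒n∣m N (suc k) (proj₁ (≡ᵇ∧≡ᵇ⇒≡×≡ {c = gcud (suc k) (N / suc k)} {d = 1} isBUD))

isBiunitaryDivisor-∣ : ∀ {d N} .{{_ : NonZero d}} → d ∣ N →
                       isBiunitaryDivisor d N ≡ (gcud d (N / d) ≡ᵇ 1)
isBiunitaryDivisor-∣ {suc k} {N} d∣N rewrite n∣m⇒m%n≡0 N (suc k) d∣N = refl

biunitaryTerm : ℕ → ℕ → ℕ
biunitaryTerm d N = if isBiunitaryDivisor d N then d else 0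

biunitaryTerm-true : ∀ {d N} → isBiunitaryDivisor d N ≡ true → biunitaryTerm d N ≡ d
biunitaryTerm-true {d} = cong (if_then d else 0)

biunitaryTerm-false : ∀ {d N} → isBiunitaryDivisor d N ≡ false → biunitaryTerm d N ≡ 0
biunitaryTerm-false {d} = cong (if_then d else 0)

σ**UpTo-skip : ∀ {a b N} → a ≤′ b → (∀ {x} → a < x → x ≤ b → isBiunitaryDivisor x N ≡ false) →
               σ**UpTo b N ≡ σ**UpTo a N
σ**UpTo-skip ≤′-refl _ = refl
σ**UpTo-skip {b = suc b} {N} (≤′-step a≤′b) none =
  trans (cong (_+ σ**UpTo b N) (biunitaryTerm-false {suc b} {N} (none (s≤s (≤′⇒≤ a≤′b)) ≤-refl)))
        (σ**UpTo-skip a≤′b (λ a<x x≤b → none a<x (m≤n⇒m≤1+n x≤b)))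

σ**UpTo-gap : ∀ {a b N} → a < b → (∀ {x} → a < x → x < b → isBiunitaryDivisor x N ≡ false) →
              σ**UpTo b N ≡ biunitaryTerm b N + σ**UpTo a N
σ**UpTo-gap {b = suc b} {N} (s≤s a≤b) none =
  cong (biunitaryTerm (suc b) N +_) (σ**UpTo-skip (≤⇒≤′ a≤b) (λ a<x x≤b → none a<x (s≤s x≤b)))

^-cancelˡ-≤ : ∀ m {i j} → 1 < m → m ^ i ≤ m ^ j → i ≤ j
^-cancelˡ-≤ m 1<m m^i≤m^j = ≮⇒≥ λ j<i → <⇒≱ (^-monoʳ-< m 1<m j<i) m^i≤m^j

^-cancelˡ-< : ∀ m .{{_ : NonZero m}} {i j} → m ^ i < m ^ j → i < j
^-cancelˡ-< m m^i<m^j = ≰⇒> λ j≤i → <⇒≱ m^i<m^j (^-monoʳ-≤ m j≤i)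

^-cancelˡ-≡ : ∀ m {i j} → 1 < m → m ^ i ≡ m ^ j → i ≡ j
^-cancelˡ-≡ m 1<m eq =
  ≤-antisym (^-cancelˡ-≤ m 1<m (≤-reflexive eq)) (^-cancelˡ-≤ m 1<m (≤-reflexive (sym eq)))

^-split : ∀ m {i j} → i ≤ j → m ^ j ≡ m ^ (j ∸ i) * m ^ i
^-split m {i} {j} i≤j = trans (cong (m ^_) (sym (m∸n+n≡m i≤j))) (^-distribˡ-+-* m (j ∸ i) i)

>1⇒[≡ᵇ1]≡false : ∀ {n} → 1 < n → (n ≡ᵇ 1) ≡ false
>1⇒[≡ᵇ1]≡false {suc (suc _)} _ = refl
>1⇒[≡ᵇ1]≡false {suc zero} (s≤s ())

module _ {p : ℕ} (p-prime : Prime p) where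

  private
    instance
      p≢0 : NonZero p
      p≢0 = prime⇒nonZero p-prime

    1<p : 1 < p
    1<p = nonTrivial⇒n>1 p {{prime⇒nonTrivial p-prime}}

  ∣p^k⇒≡p^i : ∀ {d} k → d ∣ p ^ k → ∃[ i ] d ≡ p ^ i
  ∣p^k⇒≡p^i zero d∣1 = 0 , ∣1⇒≡1 d∣1
  ∣p^k⇒≡p^i {d} (suc k) d∣p^[1+k] with p ∣? d
  ... | yes (divides e refl) =
    let e∣p^k = *-cancelʳ-∣ {e} {p ^ k} p (subst (e * p ∣_) (*-comm p (p ^ k)) d∣p^[1+k])
        i , e≡p^i = ∣p^k⇒≡p^i {e} k e∣p^k
    in  suc i , trans (cong (_* p) e≡p^i) (*-comm (p ^ i) p)
  ... | no p∤d = ∣p^k⇒≡p^i k (coprime-divisor coprime[d,p] d∣p^[1+k])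
    where
    coprime[d,p] : Coprime d p
    coprime[d,p] (c∣d , c∣p) with prime⇒irreducible p-prime c∣p
    ... | inj₁ c≡1 = c≡1
    ... | inj₂ refl = contradiction c∣d p∤d

  coprime-divisors[p^k] : ∀ {x y k} → x ∣ p ^ k → y ∣ p ^ k → Coprime x y → x ≡ 1 ⊎ y ≡ 1
  coprime-divisors[p^k] {k = k} x∣p^k y∣p^k coprime with ∣p^k⇒≡p^i k x∣p^k | ∣p^k⇒≡p^i k y∣p^k
  ... | zero  , x≡1  | _            = inj₁ x≡1
  ... | suc _ , _    | zero  , y≡1  = inj₂ y≡1
  ... | suc i , refl | suc j , refl =
    contradiction (coprime (m∣m*n (p ^ i) , m∣m*n (p ^ j)))
                  (nonTrivial⇒≢1 {{prime⇒nonTrivial p-prime}})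

  isUnitaryDivisor[d,p^k]⇒d≡1∨d≡p^k : ∀ {d k} → isUnitaryDivisor d (p ^ k) ≡ true →
                                      d ≡ 1 ⊎ d ≡ p ^ k
  isUnitaryDivisor[d,p^k]⇒d≡1∨d≡p^k {d@(suc _)} {k} isUD
    with d∣p^k , coprime ← isUnitaryDivisor⇒∣×coprime {d} {p ^ k} isUD
    with coprime-divisors[p^k] {d} {p ^ k / d} {k} d∣p^k (m/n∣m d∣p^k) coprime
  ... | inj₁ d≡1         = inj₁ d≡1
  ... | inj₂ [p^k/d]≡1 = inj₂ (begin
    d                ≡⟨ *-identityʳ d ⟨
    d * 1            ≡⟨ cong (d *_) [p^k/d]≡1 ⟨
    d * (p ^ k / d)  ≡⟨ m*[n/m]≡n {d} {p ^ k} d∣p^k ⟩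
    p ^ k            ∎)

  isBiunitaryDivisor[p^j,p^f] : ∀ {j f} → j ≤ f →
                                isBiunitaryDivisor (p ^ j) (p ^ f) ≡ (gcud (p ^ j) (p ^ (f ∸ j)) ≡ᵇ 1)
  isBiunitaryDivisor[p^j,p^f] {j} {f} j≤f = begin
    isBiunitaryDivisor (p ^ j) (p ^ f)
      ≡⟨ isBiunitaryDivisor-∣ (divides (p ^ (f ∸ j)) (^-split p j≤f)) ⟩
    (gcud (p ^ j) (p ^ f / p ^ j) ≡ᵇ 1)
      ≡⟨ cong (λ x → gcud (p ^ j) (x / p ^ j) ≡ᵇ 1) (^-split p j≤f) ⟩
    (gcud (p ^ j) (p ^ (f ∸ j) * p ^ j / p ^ j) ≡ᵇ 1)
      ≡⟨ cong (λ x → gcud (p ^ j) x ≡ᵇ 1) (m*n/n≡m _ (p ^ j)) ⟩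
    (gcud (p ^ j) (p ^ (f ∸ j)) ≡ᵇ 1) ∎
    where instance _ = m^n≢0 p j

  isBiunitaryDivisor[p^j,p^f]≡true : ∀ {j f} → j ≤ f → j * 2 ≢ f →
                                     isBiunitaryDivisor (p ^ j) (p ^ f) ≡ true
  isBiunitaryDivisor[p^j,p^f]≡true {j} {f} j≤f j*2≢f =
    trans (isBiunitaryDivisor[p^j,p^f] j≤f) (cong (_≡ᵇ 1) (gcud≡1 {{m^n≢0 p j}} onlyOne))
    where
    onlyOne : ∀ g → isUnitaryDivisor g (p ^ j) ≡ true → isUnitaryDivisor g (p ^ (f ∸ j)) ≡ true →
              g ≡ 1
    onlyOne g g∣ᵤp^j g∣ᵤp^[f∸j]
      with isUnitaryDivisor[d,p^k]⇒d≡1∨d≡p^k {g} {j} g∣ᵤp^j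
         | isUnitaryDivisor[d,p^k]⇒d≡1∨d≡p^k {g} {f ∸ j} g∣ᵤp^[f∸j]
    ... | inj₁ g≡1 | _        = g≡1
    ... | inj₂ _   | inj₁ g≡1 = g≡1
    ... | inj₂ g≡p^j | inj₂ g≡p^[f∸j] = contradiction (begin
      j * 2        ≡⟨ m*2≡m+m j ⟩
      j + j        ≡⟨ cong (j +_) (^-cancelˡ-≡ p {j} {f ∸ j} 1<p (trans (sym g≡p^j) g≡p^[f∸j])) ⟩
      j + (f ∸ j)  ≡⟨ m+[n∸m]≡n j≤f ⟩
      f            ∎) j*2≢f

  isBiunitaryDivisor[p^s,p^2s]≡false : ∀ s →
                                       isBiunitaryDivisor (p ^ suc s) (p ^ (suc s * 2)) ≡ false
  isBiunitaryDivisor[p^s,p^2s]≡false s = begin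
    isBiunitaryDivisor (p ^ suc s) (p ^ (suc s * 2))
      ≡⟨ isBiunitaryDivisor[p^j,p^f] (m≤m*n (suc s) 2) ⟩
    (gcud (p ^ suc s) (p ^ (suc s * 2 ∸ suc s)) ≡ᵇ 1)
      ≡⟨ cong (λ i → gcud (p ^ suc s) (p ^ i) ≡ᵇ 1) [1+s]*2∸[1+s]≡1+s ⟩
    (gcud (p ^ suc s) (p ^ suc s) ≡ᵇ 1)
      ≡⟨ cong (_≡ᵇ 1) (gcud[n,n]≡n (p ^ suc s) {{m^n≢0 p (suc s)}}) ⟩
    (p ^ suc s ≡ᵇ 1)
      ≡⟨ >1⇒[≡ᵇ1]≡false (^-monoʳ-< p 1<p {0} {suc s} (s≤s z≤n)) ⟩
    false ∎
    where
    [1+s]*2∸[1+s]≡1+s : suc s * 2 ∸ suc s ≡ suc s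
    [1+s]*2∸[1+s]≡1+s = trans (cong (_∸ suc s) (m*2≡m+m (suc s))) (m+n∸n≡m (suc s) (suc s))

  biunitaryTerm[p^j,p^f] : ∀ {j f} → j ≤ f → j * 2 ≢ f → biunitaryTerm (p ^ j) (p ^ f) ≡ p ^ j
  biunitaryTerm[p^j,p^f] {j} {f} j≤f j*2≢f =
    biunitaryTerm-true {p ^ j} {p ^ f} (isBiunitaryDivisor[p^j,p^f]≡true j≤f j*2≢f)

  biunitaryTerm[p^s,p^2s] : ∀ s → biunitaryTerm (p ^ suc s) (p ^ (suc s * 2)) ≡ 0
  biunitaryTerm[p^s,p^2s] s =
    biunitaryTerm-false {p ^ suc s} {p ^ (suc s * 2)} (isBiunitaryDivisor[p^s,p^2s]≡false s)

  σ**UpTo[p^[1+k],p^f] : ∀ {f} k →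
    σ**UpTo (p ^ suc k) (p ^ f) ≡ biunitaryTerm (p ^ suc k) (p ^ f) + σ**UpTo (p ^ k) (p ^ f)
  σ**UpTo[p^[1+k],p^f] {f} k = σ**UpTo-gap (^-monoʳ-< p 1<p (n<1+n k)) noPowerBetween
    where
    noPowerBetween : ∀ {x} → p ^ k < x → x < p ^ suc k → isBiunitaryDivisor x (p ^ f) ≡ false
    noPowerBetween {x} p^k<x x<p^[1+k] = ¬-not λ x-isBUD →
      let i , x≡p^i = ∣p^k⇒≡p^i f (isBiunitaryDivisor⇒∣ x-isBUD)
          k<i = ^-cancelˡ-< p {k} {i} (subst (p ^ k <_) x≡p^i p^k<x)
          i<1+k = ^-cancelˡ-< p {i} {suc k} (subst (_< p ^ suc k) x≡p^i x<p^[1+k])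
      in <-irrefl refl (≤-trans k<i (≤-pred i<1+k))

  σ**UpTo[p^k,p^f] : ∀ {f} k → k ≤ f → (∀ {j} → j ≤ k → j * 2 ≢ f) →
                     σ**UpTo (p ^ k) (p ^ f) ≡ repunit p (suc k)
  σ**UpTo[p^k,p^f] {f} zero _ allBiunitary =
    cong (_+ 0) (biunitaryTerm[p^j,p^f] {0} {f} z≤n (allBiunitary z≤n))
  σ**UpTo[p^k,p^f] {f} (suc k) 1+k≤f allBiunitary = begin
    σ**UpTo (p ^ suc k) (p ^ f)
      ≡⟨ σ**UpTo[p^[1+k],p^f] {f} k ⟩
    biunitaryTerm (p ^ suc k) (p ^ f) + σ**UpTo (p ^ k) (p ^ f)
      ≡⟨ cong₂ _+_ (biunitaryTerm[p^j,p^f] 1+k≤f (allBiunitary ≤-refl))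
                   (σ**UpTo[p^k,p^f] k (<⇒≤ 1+k≤f) (allBiunitary ∘ m≤n⇒m≤1+n)) ⟩
    p ^ suc k + repunit p (suc k) ∎

  σ**UpTo[p^k,p^2s]+p^s : ∀ {s k} → suc s ≤′ k → k ≤ suc s * 2 →
                          σ**UpTo (p ^ k) (p ^ (suc s * 2)) + p ^ suc s ≡ repunit p (suc k)
  σ**UpTo[p^k,p^2s]+p^s {s} ≤′-refl _ = begin
    σ**UpTo (p ^ suc s) N + p ^ suc s
      ≡⟨ cong (_+ p ^ suc s) (σ**UpTo[p^[1+k],p^f] {suc s * 2} s) ⟩
    (biunitaryTerm (p ^ suc s) N + σ**UpTo (p ^ s) N) + p ^ suc s
      ≡⟨ cong (λ x → (x + σ**UpTo (p ^ s) N) + p ^ suc s) (biunitaryTerm[p^s,p^2s] s) ⟩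
    σ**UpTo (p ^ s) N + p ^ suc s
      ≡⟨ cong (_+ p ^ suc s) (σ**UpTo[p^k,p^f] s (≤-trans (n≤1+n s) (m≤m*n (suc s) 2)) below) ⟩
    repunit p (suc s) + p ^ suc s
      ≡⟨ +-comm (repunit p (suc s)) (p ^ suc s) ⟩
    repunit p (suc (suc s)) ∎
    where
    N = p ^ (suc s * 2)
    below : ∀ {j} → j ≤ s → j * 2 ≢ suc s * 2
    below j≤s eq = <-irrefl eq (*-monoˡ-< 2 (s≤s j≤s))
  σ**UpTo[p^k,p^2s]+p^s {s} {suc k} (≤′-step 1+s≤′k) 1+k≤f = begin
    σ**UpTo (p ^ suc k) N + p ^ suc s
      ≡⟨ cong (_+ p ^ suc s) (σ**UpTo[p^[1+k],p^f] {suc s * 2} k) ⟩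
    (biunitaryTerm (p ^ suc k) N + σ**UpTo (p ^ k) N) + p ^ suc s
      ≡⟨ +-assoc (biunitaryTerm (p ^ suc k) N) _ _ ⟩
    biunitaryTerm (p ^ suc k) N + (σ**UpTo (p ^ k) N + p ^ suc s)
      ≡⟨ cong₂ _+_ (biunitaryTerm[p^j,p^f] 1+k≤f above)
                   (σ**UpTo[p^k,p^2s]+p^s 1+s≤′k (<⇒≤ 1+k≤f)) ⟩
    p ^ suc k + repunit p (suc k) ∎
    where
    N = p ^ (suc s * 2)
    above : suc k * 2 ≢ suc s * 2
    above eq = <-irrefl (sym eq) (*-monoˡ-< 2 (s≤s (≤′⇒≤ 1+s≤′k)))

  σ**[p^[2t-1]] : ∀ t .{{_ : NonZero t}} → σ** (p ^ pred (t * 2)) ≡ repunit p t * (1 + p ^ t)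
  σ**[p^[2t-1]] (suc t) = begin
    σ** (p ^ suc (t * 2))
      ≡⟨ σ**UpTo[p^k,p^f] (suc (t * 2)) ≤-refl (λ {j} _ → j*2≢1+t*2 j) ⟩
    repunit p (suc t * 2)
      ≡⟨ repunit-double p (suc t) ⟩
    repunit p (suc t) * (1 + p ^ suc t) ∎
    where
    j*2≢1+t*2 : ∀ j → j * 2 ≢ suc (t * 2)
    j*2≢1+t*2 j eq = even≢odd j t (trans (*-comm 2 j) (trans eq (cong suc (*-comm t 2))))

  σ**[p^[2s]] : ∀ s .{{_ : NonZero s}} → σ** (p ^ (s * 2)) ≡ repunit p s * (1 + p ^ suc s)
  σ**[p^[2s]] (suc s) = +-cancelʳ-≡ (p ^ suc s) _ _ (begin
    σ** (p ^ (suc s * 2)) + p ^ suc s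
      ≡⟨ σ**UpTo[p^k,p^2s]+p^s (≤⇒≤′ (m≤m*n (suc s) 2)) ≤-refl ⟩
    repunit p (suc (suc s * 2))
      ≡⟨ cong (repunit p) (lemma₁ s) ⟩
    repunit p (suc (suc s) + suc s)
      ≡⟨ repunit-+ p (suc (suc s)) (suc s) ⟩
    (p ^ suc s + repunit p (suc s)) + p ^ suc (suc s) * repunit p (suc s)
      ≡⟨ lemma₂ (p ^ suc s) (repunit p (suc s)) (p ^ suc (suc s)) ⟩
    repunit p (suc s) * (1 + p ^ suc (suc s)) + p ^ suc s ∎)
    where
    lemma₁ : ∀ s → suc (suc s * 2) ≡ suc (suc s) + suc s
    lemma₁ = solve-∀
    lemma₂ : ∀ a r x → (a + r) + x * r ≡ r * (1 + x) + a
    lemma₂ = solve-∀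

-- Least prime divisors

roughDivisorFrom : ∀ {n} m k → m + k ≡ n → 2 ≤ m → m Rough n → ∃[ d ] 2 ≤ d × d Rough n × d ∣ n
roughDivisorFrom {n} m k m+k≡n 2≤m rough with m ∣? n
... | yes m∣n = m , 2≤m , rough , m∣n
roughDivisorFrom m zero    m+0≡n 2≤m rough | no m∤n =
  contradiction (subst (m ∣_) (trans (sym (+-identityʳ m)) m+0≡n) ∣-refl) m∤n
roughDivisorFrom m (suc k) m+k≡n 2≤m rough | no m∤n =
  roughDivisorFrom (suc m) k (trans (sym (+-suc m k)) m+k≡n) (m≤n⇒m≤1+n 2≤m) (∤⇒rough-suc m∤n rough)

leastPrimeDivisor : ∀ {n} → 2 ≤ n → ∃[ p ] Prime p × p ∣ n × p Rough n
leastPrimeDivisor {n} 2≤n with roughDivisorFrom 2 (n ∸ 2) (m+[n∸m]≡n 2≤n) ≤-refl 2-rough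
... | p , 2≤p , rough , p∣n = p , rough∧∣⇒prime {{n>1⇒nonTrivial 2≤p}} rough p∣n , p∣n , rough

primeDivisor : ∀ {n} → 2 ≤ n → ∃[ p ] Prime p × p ∣ n
primeDivisor 2≤n with leastPrimeDivisor 2≤n
... | p , p-prime , p∣n , _ = p , p-prime , p∣n

¬prime⇒primeDivisor≤√ : ∀ {n} → 2 ≤ n → ¬ Prime n → ∃[ p ] Prime p × p ∣ n × p * p ≤ n
¬prime⇒primeDivisor≤√ 2≤n ¬prime with leastPrimeDivisor 2≤n
... | p , p-prime , p∣n , rough =
  p , p-prime , p∣n , ≮⇒≥ (¬prime ∘ rough∧square>⇒prime {{n>1⇒nonTrivial 2≤n}} rough)

prime>2⇒odd : ∀ {p} → Prime p → 2 < p → p % 2 ≡ 1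
prime>2⇒odd {p} p-prime 2<p with p % 2 in p%2≡r | m%n<n p 2
... | 0 | _ with prime⇒irreducible p-prime (m%n≡0⇒n∣m p 2 p%2≡r)
...   | inj₁ ()
...   | inj₂ 2≡p = contradiction 2≡p (<⇒≢ 2<p)
prime>2⇒odd p-prime 2<p | 1 | _ = refl
prime>2⇒odd p-prime 2<p | suc (suc _) | s≤s (s≤s ())

prime≤5⇒∣30 : ∀ {p} → Prime p → p ≤ 5 → p ∣ 30
prime≤5⇒∣30 {2} _ _ = divides 15 refl
prime≤5⇒∣30 {3} _ _ = divides 10 refl
prime≤5⇒∣30 {4} 4-prime _ = contradiction composite[4] (prime⇒¬composite 4-prime)
prime≤5⇒∣30 {5} _ _ = divides 6 refl
prime≤5⇒∣30 {0} ()
prime≤5⇒∣30 {1} ()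
prime≤5⇒∣30 {suc (suc (suc (suc (suc (suc _)))))} _ (s≤s (s≤s (s≤s (s≤s (s≤s ())))))

coprime[n,30]∧prime∣n⇒5<p : ∀ {n p} → Coprime n 30 → Prime p → p ∣ n → 5 < p
coprime[n,30]∧prime∣n⇒5<p coprime p-prime p∣n =
  ≰⇒> λ p≤5 → ¬prime[1] (subst Prime (coprime (p∣n , prime≤5⇒∣30 p-prime p≤5)) p-prime)

coprime-+-* : ∀ {r n} m → Coprime r n → Coprime (r + m * n) n
coprime-+-* {r} {n} m coprime {d} (d∣r+mn , d∣n) =
  coprime (∣m+n∣m⇒∣n (subst (d ∣_) (+-comm r (m * n)) d∣r+mn) (∣n⇒∣m*n m d∣n) , d∣n)

-- Prime divisors of base-3 repunits

repunit3-suc-suc : ∀ k → repunit 3 (2 + k) ≡ 4 + 9 * repunit 3 k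
repunit3-suc-suc k = begin
  repunit 3 (2 + k)               ≡⟨ repunit-horner 3 (1 + k) ⟩
  1 + 3 * repunit 3 (1 + k)       ≡⟨ cong (λ x → 1 + 3 * x) (repunit-horner 3 k) ⟩
  1 + 3 * (1 + 3 * repunit 3 k)   ≡⟨ lemma (repunit 3 k) ⟩
  4 + 9 * repunit 3 k             ∎
  where
  lemma : ∀ x → 1 + 3 * (1 + 3 * x) ≡ 4 + 9 * x
  lemma = solve-∀

2≤repunit3[2+k] : ∀ k → 2 ≤ repunit 3 (2 + k)
2≤repunit3[2+k] k = subst (2 ≤_) (sym (repunit3-suc-suc k)) (s≤s (s≤s z≤n))

repunit3-odd-residue : ∀ q →
  ∃[ m ] (repunit 3 (1 + q * 2) ≡ 1 + m * 30 ⊎ repunit 3 (1 + q * 2) ≡ 13 + m * 30)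
repunit3-odd-residue zero = 0 , inj₁ refl
repunit3-odd-residue (suc q) with repunit3-odd-residue q
... | m , inj₁ r≡1 =
  9 * m , inj₂ (trans (repunit3-suc-suc (1 + q * 2)) (trans (cong (λ x → 4 + 9 * x) r≡1) (lemma m)))
  where
  lemma : ∀ m → 4 + 9 * (1 + m * 30) ≡ 13 + 9 * m * 30
  lemma = solve-∀
... | m , inj₂ r≡13 =
  4 + 9 * m ,
  inj₁ (trans (repunit3-suc-suc (1 + q * 2)) (trans (cong (λ x → 4 + 9 * x) r≡13) (lemma m)))
  where
  lemma : ∀ m → 4 + 9 * (13 + m * 30) ≡ 1 + (4 + 9 * m) * 30
  lemma = solve-∀

coprime[repunit3-odd,30] : ∀ q → Coprime (repunit 3 (1 + q * 2)) 30
coprime[repunit3-odd,30] q with repunit3-odd-residue q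
... | m , inj₁ r≡1  = subst (λ n → Coprime n 30) (sym r≡1) (coprime-+-* m (from-yes (coprime? 1 30)))
... | m , inj₂ r≡13 =
  subst (λ n → Coprime n 30) (sym r≡13) (coprime-+-* m (from-yes (coprime? 13 30)))

5∣1+3^[2+4q] : ∀ q → 5 ∣ 1 + 3 ^ (2 + q * 2 * 2)
5∣1+3^[2+4q] zero    = divides 2 refl
5∣1+3^[2+4q] (suc q) =
  ∣m+n∣m⇒∣n (subst (5 ∣_) (lemma (3 ^ (q * 2 * 2))) (∣n⇒∣m*n 81 (5∣1+3^[2+4q] q))) (divides 16 refl)
  where
  lemma : ∀ x → 81 * (1 + 3 * (3 * x)) ≡ 80 + (1 + 3 * (3 * (3 * (3 * (3 * (3 * x))))))
  lemma = solve-∀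

PrimeDivisor>5 : ℕ → Set
PrimeDivisor>5 n = ∃[ p ] Prime p × 5 < p × p ∣ n

repunit3-odd-primeDivisor>5 : ∀ q → PrimeDivisor>5 (repunit 3 (3 + q * 2))
repunit3-odd-primeDivisor>5 q =
  let p , p-prime , p∣R = primeDivisor (2≤repunit3[2+k] (1 + q * 2))
  in  p , p-prime , coprime[n,30]∧prime∣n⇒5<p (coprime[repunit3-odd,30] (suc q)) p-prime p∣R , p∣R

5∣repunit3[4] : 5 ∣ repunit 3 4
5∣repunit3[4] = divides 8 refl

41∣repunit3[8] : 41 ∣ repunit 3 8
41∣repunit3[8] = divides 80 refl

3-prime : Prime 3
3-prime = from-yes (prime? 3)

41-prime : Prime 41
41-prime = from-yes (prime? 41)

repunit3-primeDivisor>5 : ∀ T → 3 ≤ T → T ≢ 4 → PrimeDivisor>5 (repunit 3 T)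
repunit3-primeDivisor>5 = <-rec (λ T → 3 ≤ T → T ≢ 4 → PrimeDivisor>5 (repunit 3 T)) step
  where
  step : ∀ T → (∀ {U} → U < T → 3 ≤ U → U ≢ 4 → PrimeDivisor>5 (repunit 3 U)) →
         3 ≤ T → T ≢ 4 → PrimeDivisor>5 (repunit 3 T)
  step T rec 3≤T T≢4 with T divMod 2
  ... | result 0 (suc zero) refl = contradiction 3≤T λ { (s≤s ()) }
  ... | result (suc q) (suc zero) refl = repunit3-odd-primeDivisor>5 q
  ... | result 0 zero refl = contradiction 3≤T λ ()
  ... | result 1 zero refl = contradiction 3≤T λ { (s≤s (s≤s ())) }
  ... | result 2 zero refl = contradiction refl T≢4
  ... | result k@(suc (suc (suc _))) zero refl with k ≟ 4
  ...   | yes refl = 41 , 41-prime , from-yes (5 <? 41) , 41∣repunit3[8]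
  ...   | no k≢4 =
    let p , p-prime , 5<p , p∣R = rec (m<m*n k 2 (s≤s (s≤s z≤n))) (s≤s (s≤s (s≤s z≤n))) k≢4
    in  p , p-prime , 5<p , ∣-trans p∣R (repunit∣repunit-double 3 k)

repunit3-double-primeDivisor>5 : ∀ k → 3 ≤ k →
  ∃[ p ] Prime p × 5 < p × p ∣ repunit 3 (k * 2) × p * p ≤ repunit 3 (k * 2)
repunit3-double-primeDivisor>5 k@(suc _) 3≤k with k ≟ 4
... | yes refl =
  41 , 41-prime , from-yes (5 <? 41) , 41∣repunit3[8] , from-yes (41 * 41 ≤? repunit 3 8)
... | no k≢4 =
  let p , p-prime , 5<p , p∣R = repunit3-primeDivisor>5 k 3≤k k≢4
      p≤R = ∣⇒≤ {{repunit≢0 3 k}} p∣R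
  in  p , p-prime , 5<p , ∣-trans p∣R (repunit∣repunit-double 3 k) ,
      ≤-trans (*-mono-≤ p≤R p≤R) (repunit²≤repunit-double 2 k)

Alternatives : ℕ → ℕ → ℕ → Set
Alternatives f t η =
    (η ≡ 0 × Σ ℕ (λ p → Prime p × p ∣ σ** (3 ^ f) × 5 < p × p ≤ (3 ^ t ∸ 1) / 2))
    ⊎ (5 ∣ σ** (3 ^ f) × (f % 4 ≡ 2 ⊎ f ≡ 7 ⊎ f ≡ 8))
    ⊎ Σ ℕ (λ p → Prime p × p % 2 ≡ 1 × p ∣ σ** (3 ^ f) × 5 < p
                 × p * p ≤ (3 ^ (t ∸ η) ∸ 1) / 2)
    ⊎ (4 ∣ t × η ≡ 1 × Prime ((3 ^ (t ∸ 1) ∸ 1) / 2))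

alternatives-η≡0 : ∀ t → 3 ≤ t → Alternatives (pred (t * 2)) t 0
alternatives-η≡0 0 ()
alternatives-η≡0 1 (s≤s ())
alternatives-η≡0 2 (s≤s (s≤s ()))
alternatives-η≡0 t@(suc (suc (suc _))) _ with t ≟ 4
... | yes refl =
  inj₂ (inj₁ (subst (5 ∣_) (sym (σ**[p^[2t-1]] 3-prime 4)) (∣m⇒∣m*n (1 + 3 ^ 4) 5∣repunit3[4]) ,
              inj₂ (inj₁ refl)))
... | no t≢4 =
  let p , p-prime , 5<p , p∣R = repunit3-primeDivisor>5 t (s≤s (s≤s (s≤s z≤n))) t≢4
  in  inj₁ (refl , p , p-prime , subst (p ∣_) (sym (σ**[p^[2t-1]] 3-prime t)) (∣m⇒∣m*n _ p∣R) ,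
            5<p , subst (p ≤_) (sym ([[1+c]^k∸1]/c≡repunit 2 t)) (∣⇒≤ {{repunit≢0 3 t}} p∣R))

alternative-C : ∀ s .{{_ : NonZero s}} {p} → Prime p → 5 < p → p ∣ repunit 3 s →
                p * p ≤ repunit 3 s → Alternatives (s * 2) (suc s) 1
alternative-C s p-prime 5<p p∣R p²≤R = inj₂ (inj₂ (inj₁ (_ , p-prime ,
  prime>2⇒odd p-prime (≤-trans (s≤s (s≤s (s≤s z≤n))) 5<p) ,
  subst (_ ∣_) (sym (σ**[p^[2s]] 3-prime s)) (∣m⇒∣m*n _ p∣R) , 5<p ,
  subst (_ ≤_) (sym ([[1+c]^k∸1]/c≡repunit 2 s)) p²≤R)))

alternatives[s≡0[2]] : ∀ k → 2 ≤ k → Alternatives (k * 2 * 2) (suc (k * 2)) 1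
alternatives[s≡0[2]] 0 ()
alternatives[s≡0[2]] 1 (s≤s ())
alternatives[s≡0[2]] 2 _ =
  inj₂ (inj₁ (subst (5 ∣_) (sym (σ**[p^[2s]] 3-prime 4)) (∣m⇒∣m*n (1 + 3 ^ 5) 5∣repunit3[4]) ,
              inj₂ (inj₂ refl)))
alternatives[s≡0[2]] k@(suc (suc (suc _))) _ =
  let p , p-prime , 5<p , p∣R , p²≤R = repunit3-double-primeDivisor>5 k (s≤s (s≤s (s≤s z≤n)))
  in  alternative-C (k * 2) p-prime 5<p p∣R p²≤R

alternatives[s≡1[4]] : ∀ q → Alternatives ((1 + q * 2 * 2) * 2) (2 + q * 2 * 2) 1
alternatives[s≡1[4]] q = inj₂ (inj₁ (subst (5 ∣_) (sym (σ**[p^[2s]] 3-prime (1 + q * 2 * 2)))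
                                            (∣n⇒∣m*n (repunit 3 (1 + q * 2 * 2)) (5∣1+3^[2+4q] q)) ,
                                     inj₁ f%4≡2))
  where
  f%4≡2 : (1 + q * 2 * 2) * 2 % 4 ≡ 2
  f%4≡2 = trans (cong (_% 4) (lemma q)) ([m+kn]%n≡m%n 2 (q * 2) 4)
    where
    lemma : ∀ q → (1 + q * 2 * 2) * 2 ≡ 2 + q * 2 * 4
    lemma = solve-∀

alternatives[s≡3[4]] : ∀ q → Alternatives ((3 + q * 2 * 2) * 2) (4 + q * 2 * 2) 1
alternatives[s≡3[4]] q = byPrimality (prime? (repunit 3 (3 + q * 2 * 2)))
  where
  byPrimality : Dec (Prime (repunit 3 (3 + q * 2 * 2))) →
                Alternatives ((3 + q * 2 * 2) * 2) (4 + q * 2 * 2) 1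
  byPrimality (yes R-prime) =
    inj₂ (inj₂ (inj₂ (divides (suc q) (cong (4 +_) (*-assoc q 2 2)) , refl ,
                      subst Prime (sym ([[1+c]^k∸1]/c≡repunit 2 (3 + q * 2 * 2))) R-prime)))
  byPrimality (no ¬R-prime) =
    let p , p-prime , p∣R , p²≤R = ¬prime⇒primeDivisor≤√ (2≤repunit3[2+k] (1 + q * 2 * 2)) ¬R-prime
    in  alternative-C (3 + q * 2 * 2) p-prime
          (coprime[n,30]∧prime∣n⇒5<p (coprime[repunit3-odd,30] (1 + q * 2)) p-prime p∣R) p∣R p²≤R

alternatives-η≡1 : ∀ t → 4 ≤ t → Alternatives (pred (pred (t * 2))) t 1
alternatives-η≡1 (suc s) (s≤s 3≤s) with s divMod 2
... | result k zero refl = alternatives[s≡0[2]] k (*-cancelʳ-< 2 1 k 3≤s)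
... | result k (suc zero) refl with k divMod 2
...   | result q zero refl       = alternatives[s≡1[4]] q
...   | result q (suc zero) refl = alternatives[s≡3[4]] q

lemma2p5 : (f t η : ℕ) → η ≤ 1 → f + 1 + η ≡ 2 * t → 5 ≤ f →
    -- (A)
    (η ≡ 0 × Σ ℕ (λ p → Prime p × p ∣ σ** (3 ^ f) × 5 < p × p ≤ (3 ^ t ∸ 1) / 2))
    -- (B)
    ⊎ (5 ∣ σ** (3 ^ f) × (f % 4 ≡ 2 ⊎ f ≡ 7 ⊎ f ≡ 8))
    -- (C)   (p ≤ √x  written as  p * p ≤ x)
    ⊎ Σ ℕ (λ p → Prime p × p % 2 ≡ 1 × p ∣ σ** (3 ^ f) × 5 < p
                 × p * p ≤ (3 ^ (t ∸ η) ∸ 1) / 2)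
    -- (D)
    ⊎ (4 ∣ t × η ≡ 1 × Prime ((3 ^ (t ∸ 1) ∸ 1) / 2))
lemma2p5 f t 0 _ f+1+0≡2t 5≤f =
  subst (λ f → Alternatives f t 0) (cong pred (sym 1+f≡t*2)) (alternatives-η≡0 t 3≤t)
  where
  1+f≡t*2 : suc f ≡ t * 2
  1+f≡t*2 = trans (lemma f) (trans f+1+0≡2t (*-comm 2 t))
    where
    lemma : ∀ f → suc f ≡ f + 1 + 0
    lemma = solve-∀
  3≤t : 3 ≤ t
  3≤t = *-cancelʳ-≤ 3 t 2 (subst (6 ≤_) 1+f≡t*2 (s≤s 5≤f))
lemma2p5 f t 1 _ f+1+1≡2t 5≤f =
  subst (λ f → Alternatives f t 1) (cong (pred ∘ pred) (sym 2+f≡t*2)) (alternatives-η≡1 t 4≤t)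
  where
  2+f≡t*2 : suc (suc f) ≡ t * 2
  2+f≡t*2 = trans (lemma f) (trans f+1+1≡2t (*-comm 2 t))
    where
    lemma : ∀ f → suc (suc f) ≡ f + 1 + 1
    lemma = solve-∀
  4≤t : 4 ≤ t
  4≤t = *-cancelʳ-< 2 3 t (subst (7 ≤_) 2+f≡t*2 (s≤s (s≤s 5≤f)))
lemma2p5 f t (suc (suc _)) (s≤s ()) _ _
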